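{- Let $G$ be a group, $A\subseteq G$, and let $F$ be a finite subset of $G$. Then $\Delta(FA)=F\,\Delta(A)\,F^{ -1}$.
   Context: For a group $G$ and $A\subseteq G$, $\Delta(A)=\{g\in G:|gA\cap A|=\infty\}$; $FA=\{fa:f\in F,a\in A\}$ and $F\Delta(A)F^{ -1}=\{f_1gf_2^{ -1}:f_1,f_2\in F,\ g\in\Delta(A)\}$. -}

module Defs where

open import Level using (Level; _⊔_)
open import Algebra.Bundles using (Group)
open import Data.List using (List)
open import Data.List.Membership.Propositional using (_∈_)
open import Data.List.Relation.Unary.Any using (Any)
open import Data.Product using (Σ; ∃; _×_)
open import Relation.Nullary using (¬_)
open import Relation.Unary using (Pred)

module GroupSets {c ℓ : Level} (G : Group c ℓ) where
  open Group G

  Finite : ∀ {a} → Pred Carrier a → Set (c ⊔ ℓ ⊔ a)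
  Finite S = ∃ λ (xs : List Carrier) → ∀ x → S x → Any (x ≈_) xs

  Infinite : ∀ {a} → Pred Carrier a → Set (c ⊔ ℓ ⊔ a)
  Infinite S = ¬ Finite S

  translate : ∀ {a} → Carrier → Pred Carrier a → Pred Carrier (c ⊔ ℓ ⊔ a)
  translate g A x = ∃ λ y → A y × x ≈ g ∙ y

  transInter : ∀ {a} → Carrier → Pred Carrier a → Pred Carrier (c ⊔ ℓ ⊔ a)
  transInter g A x = translate g A x × A x

  Δ : ∀ {a} → Pred Carrier a → Pred Carrier (c ⊔ ℓ ⊔ a)
  Δ A g = Infinite (transInter g A)

  prodFA : ∀ {a} → List Carrier → Pred Carrier a → Pred Carrier (c ⊔ ℓ ⊔ a)
  prodFA F A x = ∃ λ f → ∃ λ y → f ∈ F × A y × x ≈ f ∙ y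

  conjSet : ∀ {a} → List Carrier → Pred Carrier a → Pred Carrier (c ⊔ ℓ ⊔ a)
  conjSet F D x = ∃ λ f₁ → ∃ λ f₂ → ∃ λ g →
    f₁ ∈ F × f₂ ∈ F × D g × x ≈ (f₁ ∙ g) ∙ f₂ ⁻¹

module Submission where

-- Write H(f₁,f₂) = f₁⁻¹ g f₂ (called shift below).  The whole argument rests
-- on the decomposition
--
--     gFA ∩ FA  ⊆  ⋃_{f₁,f₂ ∈ F}  f₁ · (H(f₁,f₂) A ∩ A),
--
-- together with the converse inclusion  hA ∩ A ⊆ f₁⁻¹ · (xFA ∩ FA)  whenever
-- x = f₁ h f₂⁻¹ with f₁, f₂ ∈ F.
--
-- The theorem follows: if gFA ∩ FA
-- is infinite, one piece H(f₁,f₂)A ∩ A is infinite and g = f₁ H(f₁,f₂) f₂⁻¹;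
-- conversely a finite xFA ∩ FA would make hA ∩ A finite.

open import Defs
open import Level using (Level; _⊔_)
open import Algebra.Bundles using (Group)
open import Axiom.ExcludedMiddle using (ExcludedMiddle)
open import Data.List using (List; []; _∷_; _++_; map; cartesianProduct)
open import Data.List.Membership.Propositional using (_∈_)
open import Data.List.Membership.Propositional.Properties
  using (∈-cartesianProduct⁺; ∈-cartesianProduct⁻)
open import Data.List.Relation.Unary.Any using (Any; here; there)
import Data.List.Relation.Unary.Any as Any
open import Data.List.Relation.Unary.Any.Properties using (map⁺; ++⁺ˡ; ++⁺ʳ)
open import Data.Empty using (⊥-elim)
open import Data.Product using (_×_; _,_; ∃)
open import Relation.Nullary using (yes; no)
open import Relation.Unary using (Pred; _⊆_)
open import Relation.Binary.Definitions using (_Respects_)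
open import Relation.Binary.PropositionalEquality using () renaming (refl to ≡-refl)

module _ {c ℓ : Level} (G : Group c ℓ) where
  open Group G
  open GroupSets G
  open import Algebra.Properties.Group G
    using (\\-leftDividesˡ; \\-leftDividesʳ; //-rightDividesʳ; ∙-cancelˡ)
  open import Relation.Binary.Reasoning.Setoid setoid

  ⋃ : ∀ {i p} {I : Set i} → List I → (I → Pred Carrier p) → Pred Carrier (i ⊔ p)
  ⋃ is P x = ∃ λ j → j ∈ is × P j x

  finite-⊆ : ∀ {s t} {S : Pred Carrier s} {T : Pred Carrier t} →
    S ⊆ T → Finite T → Finite S
  finite-⊆ S⊆T (xs , covers) = xs , λ x Sx → covers x (S⊆T Sx)

  translate-finite : ∀ {s} {S : Pred Carrier s} f → Finite S → Finite (translate f S)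
  translate-finite {S = S} f (xs , covers) = map (f ∙_) xs , covers-fS
    where
    covers-fS : ∀ x → translate f S x → Any (x ≈_) (map (f ∙_) xs)
    covers-fS x (y , Sy , x≈fy) =
      map⁺ (Any.map (λ y≈ → trans x≈fy (∙-congˡ y≈)) (covers y Sy))

  ⋃-∷-finite : ∀ {i p} {I : Set i} {P : I → Pred Carrier p} j is →
    Finite (P j) → Finite (⋃ is P) → Finite (⋃ (j ∷ is) P)
  ⋃-∷-finite {P = P} j is (ys , coverʲ) (zs , coverˢ) = ys ++ zs , covers
    where
    covers : ∀ x → ⋃ (j ∷ is) P x → Any (x ≈_) (ys ++ zs)
    covers x (_ , here ≡-refl , Px) = ++⁺ˡ (coverʲ x Px)
    covers x (k , there k∈ , Px)  = ++⁺ʳ ys (coverˢ x (k , k∈ , Px))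

  infinite-⋃ : ∀ {i p} {I : Set i} → ExcludedMiddle (c ⊔ ℓ ⊔ p) →
    (is : List I) (P : I → Pred Carrier p) →
    Infinite (⋃ is P) → ∃ λ j → j ∈ is × Infinite (P j)
  infinite-⋃ lem [] P infinite = ⊥-elim (infinite ([] , λ { _ (_ , () , _) }))
  infinite-⋃ lem (j ∷ is) P infinite with lem {Finite (P j)}
  ... | no  infiniteʲ = j , here ≡-refl , infiniteʲ
  ... | yes finiteʲ with infinite-⋃ lem is P
                           (λ finiteˢ → infinite (⋃-∷-finite j is finiteʲ finiteˢ))
  ...   | k , k∈ , infiniteᵏ = k , there k∈ , infiniteᵏ

  -- The shift f₁⁻¹ g f₂ of g by the pair (f₁, f₂); the witness in Δ(A) for g ∈ Δ(FA).
  shift : Carrier → Carrier → Carrier → Carrier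
  shift g f₁ f₂ = f₁ ⁻¹ ∙ g ∙ f₂

  shift-conjugate : ∀ g f₁ f₂ → g ≈ f₁ ∙ shift g f₁ f₂ ∙ f₂ ⁻¹
  shift-conjugate g f₁ f₂ = sym (begin
    f₁ ∙ (f₁ ⁻¹ ∙ g ∙ f₂) ∙ f₂ ⁻¹   ≈⟨ assoc f₁ _ (f₂ ⁻¹) ⟩
    f₁ ∙ (f₁ ⁻¹ ∙ g ∙ f₂ ∙ f₂ ⁻¹)   ≈⟨ ∙-congˡ (//-rightDividesʳ f₂ (f₁ ⁻¹ ∙ g)) ⟩
    f₁ ∙ (f₁ ⁻¹ ∙ g)                ≈⟨ \\-leftDividesˡ f₁ g ⟩
    g                               ∎)

  conjugate-action : ∀ {x f₁ h f₂} y → x ≈ f₁ ∙ h ∙ f₂ ⁻¹ →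
    x ∙ (f₂ ∙ y) ≈ f₁ ∙ (h ∙ y)
  conjugate-action {x} {f₁} {h} {f₂} y x≈ = begin
    x ∙ (f₂ ∙ y)                    ≈⟨ ∙-congʳ x≈ ⟩
    f₁ ∙ h ∙ f₂ ⁻¹ ∙ (f₂ ∙ y)       ≈⟨ assoc (f₁ ∙ h) (f₂ ⁻¹) (f₂ ∙ y) ⟩
    f₁ ∙ h ∙ (f₂ ⁻¹ ∙ (f₂ ∙ y))     ≈⟨ ∙-congˡ (\\-leftDividesʳ f₂ y) ⟩
    f₁ ∙ h ∙ y                      ≈⟨ assoc f₁ h y ⟩
    f₁ ∙ (h ∙ y)                    ∎

  shift-solves : ∀ {g f₁ f₂ z} y → f₁ ∙ z ≈ g ∙ (f₂ ∙ y) → z ≈ shift g f₁ f₂ ∙ y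
  shift-solves {g} {f₁} {f₂} {z} y eq = ∙-cancelˡ f₁ z (shift g f₁ f₂ ∙ y) (begin
    f₁ ∙ z                          ≈⟨ eq ⟩
    g ∙ (f₂ ∙ y)                    ≈⟨ conjugate-action y (shift-conjugate g f₁ f₂) ⟩
    f₁ ∙ (shift g f₁ f₂ ∙ y)        ∎)

  module _ {a} (A : Pred Carrier a) (F : List Carrier) where

    piece : Carrier → Carrier × Carrier → Pred Carrier (c ⊔ ℓ ⊔ a)
    piece g (f₁ , f₂) = translate f₁ (transInter (shift g f₁ f₂) A)

    -- gFA ∩ FA is covered by the pieces indexed by F × F: a common element
    -- x = g f₂ y = f₁ z has z = H(f₁,f₂) y ∈ H(f₁,f₂)A ∩ A.
    pieces-cover : ∀ g → transInter g (prodFA F A) ⊆ ⋃ (cartesianProduct F F) (piece g)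
    pieces-cover g {x} ((u , (f₂ , y , f₂∈ , Ay , u≈) , x≈) , (f₁ , z , f₁∈ , Az , x≈f₁z)) =
      (f₁ , f₂) , ∈-cartesianProduct⁺ f₁∈ f₂∈ , z , ((y , Ay , z≈) , Az) , x≈f₁z
      where
      z≈ : z ≈ shift g f₁ f₂ ∙ y
      z≈ = shift-solves y (begin
        f₁ ∙ z         ≈⟨ sym x≈f₁z ⟩
        x              ≈⟨ x≈ ⟩
        g ∙ u          ≈⟨ ∙-congˡ u≈ ⟩
        g ∙ (f₂ ∙ y)   ∎)

    conjugate-inside : ∀ {x f₁ h f₂} → f₁ ∈ F → f₂ ∈ F → x ≈ f₁ ∙ h ∙ f₂ ⁻¹ →
      transInter h A ⊆ translate (f₁ ⁻¹) (transInter x (prodFA F A))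
    conjugate-inside {x} {f₁} {h} {f₂} f₁∈ f₂∈ x≈ {w} ((y , Ay , w≈hy) , Aw) =
      f₁ ∙ w , ((f₂ ∙ y , (f₂ , y , f₂∈ , Ay , refl) , f₁w≈) , (f₁ , w , f₁∈ , Aw , refl))
             , sym (\\-leftDividesʳ f₁ w)
      where
      f₁w≈ : f₁ ∙ w ≈ x ∙ (f₂ ∙ y)
      f₁w≈ = trans (∙-congˡ w≈hy) (sym (conjugate-action y x≈))

    -- Δ(FA) ⊆ F Δ(A) F⁻¹: some piece of the infinite set gFA ∩ FA is infinite.
    Δ-prod⊆conj : ExcludedMiddle (c ⊔ ℓ ⊔ a) → Δ (prodFA F A) ⊆ conjSet F (Δ A)
    Δ-prod⊆conj lem {g} infinite
      with infinite-⋃ lem (cartesianProduct F F) (piece g)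
             (λ finite → infinite (finite-⊆ (pieces-cover g) finite))
    ... | (f₁ , f₂) , pair∈ , infinitePiece with ∈-cartesianProduct⁻ F F pair∈
    ...   | f₁∈ , f₂∈ =
      f₁ , f₂ , shift g f₁ f₂ , f₁∈ , f₂∈
         , (λ finite → infinitePiece (translate-finite f₁ finite))
         , shift-conjugate g f₁ f₂

    -- F Δ(A) F⁻¹ ⊆ Δ(FA): a finite xFA ∩ FA would make hA ∩ A finite.
    conj⊆Δ-prod : conjSet F (Δ A) ⊆ Δ (prodFA F A)
    conj⊆Δ-prod (f₁ , f₂ , h , f₁∈ , f₂∈ , h∈Δ , x≈) finite =
      h∈Δ (finite-⊆ (conjugate-inside f₁∈ f₂∈ x≈) (translate-finite (f₁ ⁻¹) finite))

theorem1p4 : ∀ {c ℓ a : Level} → ExcludedMiddle (c ⊔ ℓ ⊔ a) →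
    (G : Group c ℓ) → (A : Pred (Group.Carrier G) a) →
    A Respects (Group._≈_ G) → (F : List (Group.Carrier G)) →
    (GroupSets.Δ G (GroupSets.prodFA G F A) ⊆ GroupSets.conjSet G F (GroupSets.Δ G A))
    × (GroupSets.conjSet G F (GroupSets.Δ G A) ⊆ GroupSets.Δ G (GroupSets.prodFA G F A))
-- The argument never needs A to respect the group equality.
theorem1p4 lem G A _ F = Δ-prod⊆conj G A F lem , conj⊆Δ-prod G A F
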